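{- Suppose $r\in \mathbb{N}$ and $0<1/n\ll 1/s \ll 1/\Delta$. Let $R$ be a graph on $[r]$. Let $\vec{M}$ and $\vec{k}$ be symmetric $r\times r$ matrices such that $k_{i,j}\in \mathbb{N}$, $M_{i,j} \leq 2\Delta s$ and $ M_{i,j}+ s^{2/3}+1\leq k_{i,j} < n/2$ for all $ij\in E(R)$. Suppose $H$ is an $r$-partite graph with vertex partition $(R,V_1,\dots, V_r)$ such that $|V_i|=n$ for all $i\in [r]$ and that for all $ij\in E(R)$ and every vertex $x\in V_i$ we have $M_{i,j}- s^{2/3}-1\leq d_{H[V_i,V_j]}(x)\leq M_{i,j} + s^{2/3}$. Then there exists a graph $H'$ with vertex partition $(R,V_1,\dots,V_r)$ such that $H\subseteq H'$ and $H'[V_i,V_j]$ is $k_{i,j}$-regular for all $ij \in E(R)$.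
   Context: Hierarchy convention: a statement holding whenever $0<1/n\ll a\ll b$ means there are non-decreasing functions such that it holds whenever each constant is at most the appropriate function of the constants to its right. For a graph $R$ on $[r]$, a graph $G$ admits (has) the vertex partition $(R,V_1,\dots,V_r)$ if $V_1,\dots,V_r$ partition $V(G)$ into independent sets and $G[V_i,V_j]$ is empty whenever $ij\notin E(R)$.
   Formalization: The matrix $\vec{M}$ has rational entries. -}

module Defs where

open import Data.Nat as ℕ using (ℕ; zero; suc)
open import Data.Integer using (+_)
open import Data.Bool using (Bool; true; false; if_then_else_)
open import Data.Fin using (Fin; zero; suc)
open import Data.Product using (_×_; _,_)
open import Data.Rational as ℚ using (ℚ; _/_)
open import Relation.Binary.PropositionalEquality using (_≡_)
open import Relation.Nullary using (¬_)

ℕ→ℚ : ℕ → ℚ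
ℕ→ℚ m = (+ m) / 1

countTrue : ∀ {n} → (Fin n → Bool) → ℕ
countTrue {zero}  p = 0
countTrue {suc n} p = (if p zero then 1 else 0) ℕ.+ countTrue (λ y → p (suc y))

record IsGraph {V : Set} (E : V → V → Bool) : Set where
  field
    sym   : ∀ u v → E u v ≡ true → E v u ≡ true
    irrefl : ∀ v → ¬ (E v v ≡ true)

record Graph (r : ℕ) : Set where
  field
    adj     : Fin r → Fin r → Bool
    isGraph : IsGraph adj
open Graph public

_∈E_ : ∀ {r} → Fin r × Fin r → Graph r → Set
(i , j) ∈E R = adj R i j ≡ true

-- A graph on the vertex set V₁ ∪ ... ∪ V_r, where V_i = {i} × Fin n (so |V_i| = n)
record PGraph (r n : ℕ) : Set where
  field
    padj     : Fin r × Fin n → Fin r × Fin n → Bool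
    pisGraph : IsGraph padj
open PGraph public

-- G has the vertex partition (R, V₁, …, V_r):
-- each V_i is independent, and G[V_i,V_j] is empty whenever ij ∉ E(R)
HasVertexPartition : ∀ {r n} → Graph r → PGraph r n → Set
HasVertexPartition {r} {n} R G =
  ∀ (i j : Fin r) (x y : Fin n) → padj G (i , x) (j , y) ≡ true → (i , j) ∈E R

deg : ∀ {r n} → PGraph r n → Fin r → Fin r → Fin n → ℕ
deg G i j x = countTrue (λ y → padj G (i , x) (j , y))

_⊆G_ : ∀ {r n} → PGraph r n → PGraph r n → Set
H ⊆G H' = ∀ u v → padj H u v ≡ true → padj H' u v ≡ true

-- Comparisons with the real number s^{2/3}, via the strictly monotone map t ↦ t³ on ℝ:
-- x ≤ s^{2/3}  ⇔  x³ ≤ s²,   s^{2/3} ≤ x  ⇔  s² ≤ x³.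
cube : ℚ → ℚ
cube x = x ℚ.* x ℚ.* x

_≤s^⅔_ : ℚ → ℕ → Set
x ≤s^⅔ s = cube x ℚ.≤ ℕ→ℚ (s ℕ.* s)

s^⅔_≤_ : ℕ → ℚ → Set
s^⅔ s ≤ x = ℕ→ℚ (s ℕ.* s) ℚ.≤ cube x

-- The hypotheses on M and k confine every degree d of H[V_i,V_j] to d < k_ij and
-- d ≤ 2Δs + s² (compare cubes with s²).  Each H[V_i,V_j] with ij ∈ E(R) is then completed
-- separately to a k_ij-regular bipartite supergraph, and the pieces are glued along R.
--
-- A bipartite graph b with all degrees ≤ T, column degrees < T and row degrees ≥ m
-- grows to a T-regular g ⊇ b by steps that add one edge net and keep all degrees ≤ T.
-- Given a row x and a column y of degree < T, either x has a non-neighbour v of degree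
-- < T (add xv), or some uv ∈ g ∖ b has xv ∉ g and uy ∉ g (replace uv by xv and uy).
-- Otherwise every non-neighbour of x is saturated, hence lies on an edge of g ∖ b whose
-- other end is a neighbour of y; as each row carries at most T ∸ m edges of g ∖ b, this
-- forces n < (T ∸ 1)(T ∸ m) + T.
module Submission where

open import Defs
open import Data.Bool using (Bool; true; false; not; _∧_; if_then_else_)
import Data.Bool.Properties as Bool
open import Data.Empty using (⊥-elim)
open import Data.Fin as Fin using (Fin; zero; suc)
import Data.Fin.Properties as Fin
open import Data.Fin.Properties using (_≟_; any?)
import Data.Integer as ℤ
import Data.Integer.Properties as ℤ
open import Data.Nat using
  (ℕ; zero; suc; pred; _+_; _*_; _∸_; _⊓_; _≤_; _<_; _≤′_; ≤′-refl; ≤′-step; _<?_; z≤n; s≤s; z<s)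
open import Data.Nat.Properties hiding (_≟_)
open import Algebra.Properties.Semiring.Sum +-*-semiring
  using (sum; ∑-comm; ∑-distrib-+; sum-cong-≗; sum-replicate-zero; *-distribʳ-sum)
import Data.Nat.Coprimality as Coprime
open import Data.Nat.Solver renaming (module +-*-Solver to ℕ-Solver)
open import Data.Product using (Σ-syntax; ∃; ∃-syntax; _×_; _,_; proj₁; proj₂)
open import Data.Rational as ℚ using (ℚ; mkℚ; 0ℚ; 1ℚ; _-_; *≤*; NonNegative; Positive; Negative)
import Data.Rational.Properties as ℚ
open import Data.Rational.Solver renaming (module +-*-Solver to ℚ-Solver)
open import Function using (_∘_)
open import Relation.Binary.PropositionalEquality
open import Relation.Nullary using (¬_; yes; no; does; _×-dec_)
open import Relation.Nullary.Decidable using (dec-true; dec-false)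

-- Degree bounds from the hypotheses on M and k

ℕ→ℚ≡mkℚ : ∀ m → ℕ→ℚ m ≡ mkℚ (ℤ.+ m) 0 (Coprime.sym (Coprime.1-coprimeTo m))
ℕ→ℚ≡mkℚ m = ℚ.normalize-coprime _

ℕ→ℚ-mono-≤ : ∀ {m n} → m ≤ n → ℕ→ℚ m ℚ.≤ ℕ→ℚ n
ℕ→ℚ-mono-≤ {m} {n} m≤n rewrite ℕ→ℚ≡mkℚ m | ℕ→ℚ≡mkℚ n =
  *≤* (subst₂ ℤ._≤_ (sym (ℤ.*-identityʳ (ℤ.+ m))) (sym (ℤ.*-identityʳ (ℤ.+ n))) (ℤ.+≤+ m≤n))

ℕ→ℚ-cancel-≤ : ∀ {m n} → ℕ→ℚ m ℚ.≤ ℕ→ℚ n → m ≤ n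
ℕ→ℚ-cancel-≤ {m} {n} le rewrite ℕ→ℚ≡mkℚ m | ℕ→ℚ≡mkℚ n with le
... | *≤* le′ = ℤ.drop‿+≤+ (subst₂ ℤ._≤_ (ℤ.*-identityʳ (ℤ.+ m)) (ℤ.*-identityʳ (ℤ.+ n)) le′)

ℕ→ℚ-homo-+ : ∀ m n → ℕ→ℚ (m + n) ≡ ℕ→ℚ m ℚ.+ ℕ→ℚ n
ℕ→ℚ-homo-+ m n rewrite ℕ→ℚ≡mkℚ m | ℕ→ℚ≡mkℚ n =
  ℚ./-cong (sym (cong₂ ℤ._+_ (ℤ.*-identityʳ (ℤ.+ m)) (ℤ.*-identityʳ (ℤ.+ n)))) refl

cube-mono-< : ∀ {p q} → 0ℚ ℚ.≤ p → p ℚ.< q → cube p ℚ.< cube q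
cube-mono-< {p} {q} 0≤p p<q = begin-strict
  p ℚ.* p ℚ.* p  ≤⟨ ℚ.*-monoˡ-≤-nonNeg (p ℚ.* p) (ℚ.<⇒≤ p<q) ⟩
  p ℚ.* p ℚ.* q  <⟨ ℚ.*-monoˡ-<-pos q p*p<q*q ⟩
  q ℚ.* q ℚ.* q  ∎
  where
  open ℚ.≤-Reasoning
  instance
    _ : NonNegative p
    _ = ℚ.nonNegative 0≤p
    _ : Positive q
    _ = ℚ.positive (ℚ.≤-<-trans 0≤p p<q)
    _ : NonNegative (p ℚ.* p)
    _ = ℚ.nonNeg*nonNeg⇒nonNeg p p
  p*p<q*q : p ℚ.* p ℚ.< q ℚ.* q
  p*p<q*q = ℚ.≤-<-trans (ℚ.*-monoˡ-≤-nonNeg p (ℚ.<⇒≤ p<q)) (ℚ.*-monoˡ-<-pos q p<q)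

cube<0 : ∀ {p} → p ℚ.< 0ℚ → cube p ℚ.< 0ℚ
cube<0 {p} p<0 = ℚ.negative⁻¹ (cube p) {{ℚ.pos*neg⇒neg (p ℚ.* p) p}}
  where
  instance
    _ : Negative p
    _ = ℚ.negative p<0
    _ : Positive (p ℚ.* p)
    _ = ℚ.neg*neg⇒pos p p

cube-cancel-≤ : ∀ {p q} → 0ℚ ℚ.≤ cube q → cube p ℚ.≤ cube q → p ℚ.≤ q
cube-cancel-≤ {p} {q} 0≤q³ p³≤q³ = ℚ.≮⇒≥ q≮p
  where
  q≮p : ¬ (q ℚ.< p)
  q≮p q<p with 0ℚ ℚ.≤? q
  ... | yes 0≤q = ℚ.<-irrefl refl (ℚ.<-≤-trans (cube-mono-< 0≤q q<p) p³≤q³)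
  ... | no 0≰q  = ℚ.<-irrefl refl (ℚ.<-≤-trans (cube<0 (ℚ.≰⇒> 0≰q)) 0≤q³)

≤-cube : ∀ {p} → 1ℚ ℚ.≤ p → p ℚ.≤ cube p
≤-cube {p} 1≤p = begin
  p              ≡⟨ sym (ℚ.*-identityˡ p) ⟩
  1ℚ ℚ.* p       ≤⟨ ℚ.*-monoʳ-≤-nonNeg p 1≤p*p ⟩
  p ℚ.* p ℚ.* p  ∎
  where
  open ℚ.≤-Reasoning
  instance
    _ : NonNegative p
    _ = ℚ.nonNegative (ℚ.≤-trans (ℚ.nonNegative⁻¹ 1ℚ) 1≤p)
  1≤p*p : 1ℚ ℚ.≤ p ℚ.* p
  1≤p*p = begin
    1ℚ        ≤⟨ 1≤p ⟩
    p         ≡⟨ sym (ℚ.*-identityˡ p) ⟩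
    1ℚ ℚ.* p  ≤⟨ ℚ.*-monoʳ-≤-nonNeg p 1≤p ⟩
    p ℚ.* p   ∎

≤s^⅔-trans : ∀ {p q s} → p ≤s^⅔ s → s^⅔ s ≤ q → p ℚ.≤ q
≤s^⅔-trans {s = s} p≤ ≤q =
  cube-cancel-≤ (ℚ.≤-trans (ℕ→ℚ-mono-≤ {n = s * s} z≤n) ≤q) (ℚ.≤-trans p≤ ≤q)

≤s^⅔⇒≤s*s : ∀ {p s} → 1 ≤ s → p ≤s^⅔ s → p ℚ.≤ ℕ→ℚ (s * s)
≤s^⅔⇒≤s*s {p} {s} 1≤s p³≤s*s with 1ℚ ℚ.≤? p
... | yes 1≤p = ℚ.≤-trans (≤-cube 1≤p) p³≤s*s
... | no 1≰p  = ℚ.≤-trans (ℚ.<⇒≤ (ℚ.≰⇒> 1≰p)) (ℕ→ℚ-mono-≤ (*-mono-≤ 1≤s 1≤s))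

degree-bounds : ∀ {s d k D} {M : ℚ} → 1 ≤ s → M ℚ.≤ ℕ→ℚ D →
  s^⅔ s ≤ (ℕ→ℚ k - M - ℕ→ℚ 1) → (ℕ→ℚ d - M) ≤s^⅔ s →
  d < k × d ≤ D + s * s
degree-bounds {s} {d} {k} {D} {M} 1≤s M≤D s^⅔≤k-M-1 d-M≤s^⅔ =
  ℕ→ℚ-cancel-≤ 1+d≤k , ℕ→ℚ-cancel-≤ d≤D+s*s
  where
  open ℚ.≤-Reasoning
  open ℚ-Solver
  d-M≤k-M-1 : ℕ→ℚ d - M ℚ.≤ ℕ→ℚ k - M - ℕ→ℚ 1
  d-M≤k-M-1 = ≤s^⅔-trans {s = s} d-M≤s^⅔ s^⅔≤k-M-1
  1+d≤k : ℕ→ℚ (suc d) ℚ.≤ ℕ→ℚ k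
  1+d≤k = begin
    ℕ→ℚ (1 + d)
      ≡⟨ ℕ→ℚ-homo-+ 1 d ⟩
    ℕ→ℚ 1 ℚ.+ ℕ→ℚ d
      ≡⟨ solve 3 (λ d M one → one :+ d := (d :- M) :+ (M :+ one)) refl (ℕ→ℚ d) M (ℕ→ℚ 1) ⟩
    (ℕ→ℚ d - M) ℚ.+ (M ℚ.+ ℕ→ℚ 1)
      ≤⟨ ℚ.+-monoˡ-≤ (M ℚ.+ ℕ→ℚ 1) d-M≤k-M-1 ⟩
    (ℕ→ℚ k - M - ℕ→ℚ 1) ℚ.+ (M ℚ.+ ℕ→ℚ 1)
      ≡⟨ solve 3 (λ k M one → (k :- M :- one) :+ (M :+ one) := k) refl (ℕ→ℚ k) M (ℕ→ℚ 1) ⟩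
    ℕ→ℚ k
      ∎
  d≤D+s*s : ℕ→ℚ d ℚ.≤ ℕ→ℚ (D + s * s)
  d≤D+s*s = begin
    ℕ→ℚ d                        ≡⟨ solve 2 (λ d M → d := M :+ (d :- M)) refl (ℕ→ℚ d) M ⟩
    M ℚ.+ (ℕ→ℚ d - M)            ≤⟨ ℚ.+-mono-≤ M≤D (≤s^⅔⇒≤s*s {ℕ→ℚ d - M} 1≤s d-M≤s^⅔) ⟩
    ℕ→ℚ D ℚ.+ ℕ→ℚ (s * s)        ≡⟨ sym (ℕ→ℚ-homo-+ D (s * s)) ⟩
    ℕ→ℚ (D + s * s)              ∎

𝟙 : Bool → ℕ
𝟙 b = if b then 1 else 0

𝟙-mono : ∀ {a b} → (a ≡ true → b ≡ true) → 𝟙 a ≤ 𝟙 b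
𝟙-mono {false} _   = z≤n
𝟙-mono {true}  a⇒b rewrite a⇒b refl = ≤-refl

countTrue-cong : ∀ {n} {p q : Fin n → Bool} → p ≗ q → countTrue p ≡ countTrue q
countTrue-cong {zero}  _   = refl
countTrue-cong {suc n} p≗q = cong₂ (λ b c → 𝟙 b + c) (p≗q zero) (countTrue-cong (p≗q ∘ suc))

countTrue-mono : ∀ {n} {p q : Fin n → Bool} → (∀ i → p i ≡ true → q i ≡ true) →
  countTrue p ≤ countTrue q
countTrue-mono {zero}  _   = z≤n
countTrue-mono {suc n} p⇒q = +-mono-≤ (𝟙-mono (p⇒q zero)) (countTrue-mono (p⇒q ∘ suc))

countTrue-false : ∀ {n} {p : Fin n → Bool} → (∀ i → p i ≡ false) → countTrue p ≡ 0
countTrue-false {zero}  _ = refl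
countTrue-false {suc n} p≡false rewrite p≡false zero = countTrue-false (p≡false ∘ suc)

countTrue-true : ∀ n → countTrue {n} (λ _ → true) ≡ n
countTrue-true zero    = refl
countTrue-true (suc n) = cong suc (countTrue-true n)

countTrue≡sum : ∀ {n} (p : Fin n → Bool) → countTrue p ≡ sum (𝟙 ∘ p)
countTrue≡sum {zero}  p = refl
countTrue≡sum {suc n} p = cong (𝟙 (p zero) +_) (countTrue≡sum (p ∘ suc))

countTrue-difference : ∀ {n} {p q : Fin n → Bool} → (∀ i → q i ≡ true → p i ≡ true) →
  countTrue (λ i → p i ∧ not (q i)) + countTrue q ≡ countTrue p
countTrue-difference {zero} _ = refl
countTrue-difference {suc n} {p} {q} q⇒p with p zero | q zero | q⇒p zero
... | true  | true  | _ = trans (+-suc _ _) (cong suc (countTrue-difference (q⇒p ∘ suc)))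
... | true  | false | _ = cong suc (countTrue-difference (q⇒p ∘ suc))
... | false | false | _ = countTrue-difference (q⇒p ∘ suc)
... | false | true  | q⇒p₀ with () ← q⇒p₀ refl

countTrue-not : ∀ {n} (p : Fin n → Bool) → countTrue (not ∘ p) + countTrue p ≡ n
countTrue-not {n} p = trans (countTrue-difference {n} {λ _ → true} {p} (λ _ _ → refl)) (countTrue-true n)

countTrue-update : ∀ {n} (p : Fin n → Bool) a β →
  countTrue (λ i → if does (i ≟ a) then β else p i) + 𝟙 (p a) ≡ countTrue p + 𝟙 β
countTrue-update {suc n} p zero β =
  solve 3 (λ b c a → b :+ c :+ a := a :+ c :+ b) refl (𝟙 β) (countTrue (p ∘ suc)) (𝟙 (p zero))
  where open ℕ-Solver
countTrue-update {suc n} p (suc a) β = begin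
  𝟙 (p zero) + countTrue p′[a]≔β + 𝟙 (p (suc a))   ≡⟨ +-assoc (𝟙 (p zero)) _ _ ⟩
  𝟙 (p zero) + (countTrue p′[a]≔β + 𝟙 (p (suc a))) ≡⟨ cong (𝟙 (p zero) +_) (countTrue-update (p ∘ suc) a β) ⟩
  𝟙 (p zero) + (countTrue (p ∘ suc) + 𝟙 β)          ≡⟨ +-assoc (𝟙 (p zero)) _ _ ⟨
  countTrue p + 𝟙 β                                  ∎
  where
  open ≡-Reasoning
  p′[a]≔β = λ i → if does (i ≟ a) then β else p (suc i)

sum-mono-≤ : ∀ {n} {f g : Fin n → ℕ} → (∀ i → f i ≤ g i) → sum f ≤ sum g
sum-mono-≤ {zero}  _   = z≤n
sum-mono-≤ {suc n} f≤g = +-mono-≤ (f≤g zero) (sum-mono-≤ (f≤g ∘ suc))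

sum-mono-< : ∀ {n} {f g : Fin n → ℕ} → (∀ i → f i ≤ g i) → ∀ a → f a < g a → sum f < sum g
sum-mono-< f≤g zero    fa<ga = +-mono-<-≤ fa<ga (sum-mono-≤ (f≤g ∘ suc))
sum-mono-< f≤g (suc a) fa<ga = +-mono-≤-< (f≤g zero) (sum-mono-< (f≤g ∘ suc) a fa<ga)

sum-≡⇒≗ : ∀ {n} {f g : Fin n → ℕ} → (∀ i → f i ≤ g i) → sum f ≡ sum g → ∀ i → f i ≡ g i
sum-≡⇒≗ f≤g Σf≡Σg i =
  ≤-antisym (f≤g i) (≮⇒≥ λ fi<gi → <-irrefl Σf≡Σg (sum-mono-< f≤g i fi<gi))

sum-<⇒∃< : ∀ {n} {f g : Fin n → ℕ} → sum f < sum g → ∃ λ i → f i < g i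
sum-<⇒∃< {zero} ()
sum-<⇒∃< {suc n} {f} {g} Σf<Σg with f zero <? g zero
... | yes f₀<g₀ = zero , f₀<g₀
... | no  f₀≮g₀ = let i , fi<gi = sum-<⇒∃< tail< in suc i , fi<gi
  where
  tail< : sum (f ∘ suc) < sum (g ∘ suc)
  tail< = +-cancelˡ-< (g zero) _ _ (≤-<-trans (+-monoˡ-≤ _ (≮⇒≥ f₀≮g₀)) Σf<Σg)

-- Bipartite graphs between two copies of Fin n

Bigraph : ℕ → Set
Bigraph n = Fin n → Fin n → Bool

rowDeg : ∀ {n} → Bigraph n → Fin n → ℕ
rowDeg g u = countTrue (g u)

colDeg : ∀ {n} → Bigraph n → Fin n → ℕ
colDeg g v = countTrue (λ u → g u v)

_⊆ᵇ_ : ∀ {n} → Bigraph n → Bigraph n → Set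
b ⊆ᵇ g = ∀ u v → b u v ≡ true → g u v ≡ true

⊆ᵇ-refl : ∀ {n} {g : Bigraph n} → g ⊆ᵇ g
⊆ᵇ-refl _ _ e = e

⊆ᵇ-trans : ∀ {n} {b g h : Bigraph n} → b ⊆ᵇ g → g ⊆ᵇ h → b ⊆ᵇ h
⊆ᵇ-trans b⊆g g⊆h u v = g⊆h u v ∘ b⊆g u v

⊆ᵇ-false : ∀ {n} {b g : Bigraph n} → b ⊆ᵇ g → ∀ {u v} → g u v ≡ false → b u v ≡ false
⊆ᵇ-false {b = b} b⊆g {u} {v} guv≡false with b u v in buv
... | false = refl
... | true  = trans (sym (b⊆g u v buv)) guv≡false

IsRegular : ∀ {n} → Bigraph n → ℕ → Set
IsRegular g k = (∀ u → rowDeg g u ≡ k) × (∀ v → colDeg g v ≡ k)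

sum-colDeg : ∀ {n} (g : Bigraph n) → sum (colDeg g) ≡ sum (rowDeg g)
sum-colDeg g = begin
  sum (colDeg g)                          ≡⟨ sum-cong-≗ (λ v → countTrue≡sum (λ u → g u v)) ⟩
  sum (λ v → sum (λ u → 𝟙 (g u v)))      ≡⟨ ∑-comm (λ u v → 𝟙 (g u v)) ⟨
  sum (λ u → sum (λ v → 𝟙 (g u v)))      ≡⟨ sum-cong-≗ (λ u → countTrue≡sum (g u)) ⟨
  sum (rowDeg g)                          ∎
  where open ≡-Reasoning

_∖_ : ∀ {n} → Bigraph n → Bigraph n → Bigraph n
(g ∖ b) u v = g u v ∧ not (b u v)

rowDeg-∖ : ∀ {n} {b g : Bigraph n} → b ⊆ᵇ g → ∀ u → rowDeg (g ∖ b) u + rowDeg b u ≡ rowDeg g u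
rowDeg-∖ b⊆g u = countTrue-difference (b⊆g u)

colDeg-∖ : ∀ {n} {b g : Bigraph n} → b ⊆ᵇ g → ∀ v → colDeg (g ∖ b) v + colDeg b v ≡ colDeg g v
colDeg-∖ b⊆g v = countTrue-difference (λ u → b⊆g u v)

setEdge : ∀ {n} → Bigraph n → Fin n → Fin n → Bool → Bigraph n
setEdge g x y β u v = if does (u ≟ x) ∧ does (v ≟ y) then β else g u v

setEdge-≢ʳ : ∀ {n} (g : Bigraph n) {x y β u} → u ≢ x → ∀ v → setEdge g x y β u v ≡ g u v
setEdge-≢ʳ g {x} {y} {β} {u} u≢x v =
  cong (λ c → if c ∧ does (v ≟ y) then β else g u v) (dec-false (u ≟ x) u≢x)

setEdge-≢ᶜ : ∀ {n} (g : Bigraph n) {x y β v} → v ≢ y → ∀ u → setEdge g x y β u v ≡ g u v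
setEdge-≢ᶜ g {x} {y} {β} {v} v≢y u = trans
  (cong (λ c → if does (u ≟ x) ∧ c then β else g u v) (dec-false (v ≟ y) v≢y))
  (cong (λ c → if c then β else g u v) (Bool.∧-zeroʳ (does (u ≟ x))))

rowDeg-setEdge : ∀ {n} (g : Bigraph n) x y {α} β → g x y ≡ α →
  rowDeg (setEdge g x y β) x + 𝟙 α ≡ rowDeg g x + 𝟙 β
rowDeg-setEdge g x y β refl =
  trans (cong (_+ 𝟙 (g x y)) (countTrue-cong row)) (countTrue-update (g x) y β)
  where
  row : ∀ v → setEdge g x y β x v ≡ (if does (v ≟ y) then β else g x v)
  row v = cong (λ c → if c ∧ does (v ≟ y) then β else g x v) (dec-true (x ≟ x) refl)

colDeg-setEdge : ∀ {n} (g : Bigraph n) x y {α} β → g x y ≡ α →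
  colDeg (setEdge g x y β) y + 𝟙 α ≡ colDeg g y + 𝟙 β
colDeg-setEdge g x y β refl =
  trans (cong (_+ 𝟙 (g x y)) (countTrue-cong col)) (countTrue-update (λ u → g u y) x β)
  where
  col : ∀ u → setEdge g x y β u y ≡ (if does (u ≟ x) then β else g u y)
  col u = trans (cong (λ c → if does (u ≟ x) ∧ c then β else g u y) (dec-true (y ≟ y) refl))
                (cong (λ c → if c then β else g u y) (Bool.∧-identityʳ (does (u ≟ x))))

⊆ᵇ-setEdge-true : ∀ {n} (g : Bigraph n) x y → g ⊆ᵇ setEdge g x y true
⊆ᵇ-setEdge-true g x y u v guv with does (u ≟ x) ∧ does (v ≟ y)
... | true  = refl
... | false = guv

setEdge-false-⊆ᵇ : ∀ {n} (g : Bigraph n) x y → setEdge g x y false ⊆ᵇ g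
setEdge-false-⊆ᵇ g x y u v with does (u ≟ x) ∧ does (v ≟ y)
... | true  = λ ()
... | false = λ guv → guv

⊆ᵇ-setEdge-false : ∀ {n} {b g : Bigraph n} {x y} → b ⊆ᵇ g → b x y ≡ false →
  b ⊆ᵇ setEdge g x y false
⊆ᵇ-setEdge-false {x = x} {y} b⊆g bxy≡false u v buv with u ≟ x | v ≟ y
... | yes refl | yes refl with () ← trans (sym buv) bxy≡false
... | yes _    | no _     = b⊆g u v buv
... | no _     | _        = b⊆g u v buv

δ : ∀ {n} → Fin n → Fin n → ℕ
δ u a = 𝟙 (does (u ≟ a))

sum-δ : ∀ {n} (a : Fin n) → sum (λ u → δ u a) ≡ 1
sum-δ {suc n} zero    = cong suc (sum-replicate-zero n)
sum-δ {suc n} (suc a) = sum-δ a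

Incremented : ∀ {n} → (Fin n → ℕ) → Fin n → (Fin n → ℕ) → Set
Incremented d a d′ = ∀ u → d′ u ≡ d u + δ u a

incremented : ∀ {n} {d d′ : Fin n → ℕ} {a} → d′ a ≡ suc (d a) → (∀ u → u ≢ a → d′ u ≡ d u) →
  Incremented d a d′
incremented {d = d} {a = a} at-a elsewhere u with u ≟ a
... | yes refl = trans at-a (+-comm 1 (d a))
... | no  u≢a  = trans (elsewhere u u≢a) (sym (+-identityʳ (d u)))

incremented-≤ : ∀ {n} {d d′ : Fin n → ℕ} {a T} → Incremented d a d′ → (∀ u → d u ≤ T) → d a < T →
  ∀ u → d′ u ≤ T
incremented-≤ {d = d} {a = a} {T} d′≡ d≤T da<T u rewrite d′≡ u with u ≟ a
... | yes refl = subst (_≤ T) (+-comm 1 (d a)) da<T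
... | no  _    = subst (_≤ T) (sym (+-identityʳ (d u))) (d≤T u)

incremented-sum : ∀ {n} {d d′ : Fin n → ℕ} {a} → Incremented d a d′ → sum d′ ≡ sum d + 1
incremented-sum {d = d} {d′} {a} d′≡ = begin
  sum d′                        ≡⟨ sum-cong-≗ d′≡ ⟩
  sum (λ u → d u + δ u a)       ≡⟨ ∑-distrib-+ d (λ u → δ u a) ⟩
  sum d + sum (λ u → δ u a)     ≡⟨ cong (sum d +_) (sum-δ a) ⟩
  sum d + 1                     ∎
  where open ≡-Reasoning

incremented-exchange : ∀ {n} {d₁ d d₂ d₃ : Fin n → ℕ} {a b} →
  Incremented d₁ a d → Incremented d₁ b d₂ → Incremented d₂ a d₃ → Incremented d b d₃
incremented-exchange {d₁ = d₁} {d} {d₂} {d₃} {a} {b} d≡ d₂≡ d₃≡ u = begin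
  d₃ u                      ≡⟨ d₃≡ u ⟩
  d₂ u + δ u a              ≡⟨ cong (_+ δ u a) (d₂≡ u) ⟩
  d₁ u + δ u b + δ u a      ≡⟨ +-assoc (d₁ u) _ _ ⟩
  d₁ u + (δ u b + δ u a)    ≡⟨ cong (d₁ u +_) (+-comm (δ u b) (δ u a)) ⟩
  d₁ u + (δ u a + δ u b)    ≡⟨ +-assoc (d₁ u) _ _ ⟨
  d₁ u + δ u a + δ u b      ≡⟨ cong (_+ δ u b) (d≡ u) ⟨
  d u + δ u b               ∎
  where open ≡-Reasoning

m+0≡n+1⇒m≡1+n : ∀ {m n} → m + 0 ≡ n + 1 → m ≡ suc n
m+0≡n+1⇒m≡1+n {m} {n} e = trans (sym (+-identityʳ m)) (trans e (+-comm n 1))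

Augmented : ∀ {n} → Bigraph n → Fin n → Fin n → Bigraph n → Set
Augmented g x y g′ = Incremented (rowDeg g) x (rowDeg g′) × Incremented (colDeg g) y (colDeg g′)

addEdge-augmented : ∀ {n} (g : Bigraph n) x y → g x y ≡ false → Augmented g x y (setEdge g x y true)
addEdge-augmented g x y gxy≡false =
  incremented (m+0≡n+1⇒m≡1+n (rowDeg-setEdge g x y true gxy≡false))
              (λ _ u≢x → countTrue-cong (setEdge-≢ʳ g u≢x)) ,
  incremented (m+0≡n+1⇒m≡1+n (colDeg-setEdge g x y true gxy≡false))
              (λ _ v≢y → countTrue-cong (setEdge-≢ᶜ g v≢y))

removeEdge-augmented : ∀ {n} (g : Bigraph n) x y → g x y ≡ true → Augmented (setEdge g x y false) x y g
removeEdge-augmented g x y gxy≡true =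
  incremented (m+0≡n+1⇒m≡1+n (sym (rowDeg-setEdge g x y false gxy≡true)))
              (λ _ u≢x → sym (countTrue-cong (setEdge-≢ʳ g u≢x))) ,
  incremented (m+0≡n+1⇒m≡1+n (sym (colDeg-setEdge g x y false gxy≡true)))
              (λ _ v≢y → sym (countTrue-cong (setEdge-≢ᶜ g v≢y)))

switch : ∀ {n} → Bigraph n → (x y u v : Fin n) → Bigraph n
switch g x y u v = setEdge (setEdge (setEdge g u v false) x v true) u y true

switch-augmented : ∀ {n} (g : Bigraph n) {x y u v} → g x v ≡ false → g u v ≡ true → g u y ≡ false →
  Augmented g x y (switch g x y u v)
switch-augmented g {x} {y} {u} {v} gxv≡false guv≡true guy≡false =
  incremented-exchange (proj₁ A₁) (proj₁ A₂) (proj₁ A₃) ,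
  λ w → trans (proj₂ A₃ w) (cong (_+ δ w y) (trans (proj₂ A₂ w) (sym (proj₂ A₁ w))))
  where
  g₁ = setEdge g u v false
  g₂ = setEdge g₁ x v true
  u≢x : u ≢ x
  u≢x refl with () ← trans (sym guv≡true) gxv≡false
  A₁ : Augmented g₁ u v g
  A₁ = removeEdge-augmented g u v guv≡true
  A₂ : Augmented g₁ x v g₂
  A₂ = addEdge-augmented g₁ x v (⊆ᵇ-false (setEdge-false-⊆ᵇ g u v) gxv≡false)
  A₃ : Augmented g₂ u y (switch g x y u v)
  A₃ = addEdge-augmented g₂ u y
         (trans (setEdge-≢ʳ g₁ u≢x y) (⊆ᵇ-false (setEdge-false-⊆ᵇ g u v) guy≡false))

⊆ᵇ-switch : ∀ {n} {b g : Bigraph n} {x y u v} → b ⊆ᵇ g → b u v ≡ false → b ⊆ᵇ switch g x y u v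
⊆ᵇ-switch {x = x} {y} {u} {v} b⊆g buv≡false =
  ⊆ᵇ-trans (⊆ᵇ-setEdge-false b⊆g buv≡false)
           (⊆ᵇ-trans (⊆ᵇ-setEdge-true _ x v) (⊆ᵇ-setEdge-true _ u y))

-- Completion to a regular bipartite graph

nonNeighbours-≤ : ∀ {n} {b g : Bigraph n} {T m} x y → b ⊆ᵇ g →
  (∀ u → rowDeg g u ≤ T) → (∀ u → m ≤ rowDeg b u) →
  (∀ v → g x v ≡ false → colDeg b v < colDeg g v) →
  (∀ u v → g x v ≡ false → g u v ≡ true → b u v ≡ false → g u y ≡ true) →
  countTrue (not ∘ g x) ≤ colDeg g y * (T ∸ m)
nonNeighbours-≤ {n} {b} {g} {T} {m} x y b⊆g rowDeg≤T m≤rowDeg b<g no-switch = begin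
  countTrue (not ∘ g x)                  ≡⟨ countTrue≡sum (not ∘ g x) ⟩
  sum (𝟙 ∘ not ∘ g x)                    ≤⟨ sum-mono-≤ column-nonempty ⟩
  sum (colDeg F)                         ≡⟨ sum-colDeg F ⟩
  sum (rowDeg F)                         ≤⟨ sum-mono-≤ row-bounded ⟩
  sum (λ u → 𝟙 (g u y) * (T ∸ m))        ≡⟨ *-distribʳ-sum (T ∸ m) (λ u → 𝟙 (g u y)) ⟨
  sum (λ u → 𝟙 (g u y)) * (T ∸ m)        ≡⟨ cong (_* (T ∸ m)) (countTrue≡sum (λ u → g u y)) ⟨
  colDeg g y * (T ∸ m)                   ∎
  where
  open ≤-Reasoning
  F : Bigraph n
  F u v = not (g x v) ∧ (g ∖ b) u v
  column-nonempty : ∀ v → 𝟙 (not (g x v)) ≤ colDeg F v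
  column-nonempty v with g x v in gxv
  ... | true  = z≤n
  ... | false = +-cancelʳ-< (colDeg b v) 0 _ (subst (colDeg b v <_) (sym (colDeg-∖ b⊆g v)) (b<g v gxv))
  F⇒∖ : ∀ u v → F u v ≡ true → (g ∖ b) u v ≡ true
  F⇒∖ u v with g x v
  ... | false = λ e → e
  ... | true  = λ ()
  F-empty : ∀ u → g u y ≡ false → ∀ v → F u v ≡ false
  F-empty u guy v with g x v in gxv | g u v in guv | b u v in buv
  ... | true  | _     | _     = refl
  ... | false | false | _     = refl
  ... | false | true  | true  = refl
  ... | false | true  | false with () ← trans (sym (no-switch u v gxv guv buv)) guy
  row-bounded : ∀ u → rowDeg F u ≤ 𝟙 (g u y) * (T ∸ m)
  row-bounded u with g u y in guy
  ... | false = ≤-reflexive (countTrue-false (F-empty u guy))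
  ... | true  = begin
    rowDeg F u                           ≤⟨ countTrue-mono (F⇒∖ u) ⟩
    rowDeg (g ∖ b) u                     ≡⟨ m+n∸n≡m _ (rowDeg b u) ⟨
    rowDeg (g ∖ b) u + rowDeg b u ∸ rowDeg b u ≡⟨ cong (_∸ rowDeg b u) (rowDeg-∖ b⊆g u) ⟩
    rowDeg g u ∸ rowDeg b u              ≤⟨ ∸-mono (rowDeg≤T u) (m≤rowDeg u) ⟩
    T ∸ m                                ≡⟨ *-identityˡ (T ∸ m) ⟨
    1 * (T ∸ m)                          ∎

module Completion {n} (T m : ℕ) (b : Bigraph n)
  (m≤rowDeg : ∀ u → m ≤ rowDeg b u) (colDeg<T : ∀ v → colDeg b v < T)
  (large : pred T * (T ∸ m) + T ≤ n) where

  record Admissible (g : Bigraph n) : Set where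
    field
      b⊆g      : b ⊆ᵇ g
      rowDeg≤T : ∀ u → rowDeg g u ≤ T
      colDeg≤T : ∀ v → colDeg g v ≤ T
  open Admissible

  capacity : ℕ
  capacity = sum {n} (λ _ → T)

  Augmentation : Bigraph n → Set
  Augmentation g = Σ[ g′ ∈ Bigraph n ] Admissible g′ × sum (rowDeg g′) ≡ sum (rowDeg g) + 1

  augmentation : ∀ {g g′ x y} → Admissible g → Augmented g x y g′ → b ⊆ᵇ g′ →
    rowDeg g x < T → colDeg g y < T → Augmentation g
  augmentation {g′ = g′} A (rows , cols) b⊆g′ x<T y<T =
    g′ , record { b⊆g = b⊆g′
                ; rowDeg≤T = incremented-≤ rows (rowDeg≤T A) x<T
                ; colDeg≤T = incremented-≤ cols (colDeg≤T A) y<T } ,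
    incremented-sum rows

  augment : ∀ {g} → Admissible g → ∀ {x y} → rowDeg g x < T → colDeg g y < T → Augmentation g
  augment {g} A {x} {y} x<T y<T with any? (λ v → (g x v Bool.≟ false) ×-dec (colDeg g v <? T))
  ... | yes (v , gxv≡false , v<T) =
    augmentation A (addEdge-augmented g x v gxv≡false) (⊆ᵇ-trans (b⊆g A) (⊆ᵇ-setEdge-true g x v)) x<T v<T
  ... | no no-free-column with any? (λ u → any? (λ v →
          (g x v Bool.≟ false) ×-dec (g u v Bool.≟ true) ×-dec
          (b u v Bool.≟ false) ×-dec (g u y Bool.≟ false)))
  ...   | yes (u , v , gxv≡false , guv≡true , buv≡false , guy≡false) =
    augmentation A (switch-augmented g gxv≡false guv≡true guy≡false) (⊆ᵇ-switch (b⊆g A) buv≡false)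
      x<T y<T
  ...   | no no-switch = ⊥-elim (<-irrefl refl (begin-strict
    n                                          ≡⟨ countTrue-not (g x) ⟨
    countTrue (not ∘ g x) + rowDeg g x         ≤⟨ +-monoˡ-≤ _ few-non-neighbours ⟩
    colDeg g y * (T ∸ m) + rowDeg g x          <⟨ +-mono-≤-< (*-monoˡ-≤ (T ∸ m) (<⇒≤pred y<T)) x<T ⟩
    pred T * (T ∸ m) + T                       ≤⟨ large ⟩
    n                                          ∎))
    where
    open ≤-Reasoning
    colDeg-b<g : ∀ v → g x v ≡ false → colDeg b v < colDeg g v
    colDeg-b<g v gxv≡false = <-≤-trans (colDeg<T v) (≮⇒≥ λ v<T → no-free-column (v , gxv≡false , v<T))
    switch-blocked : ∀ u v → g x v ≡ false → g u v ≡ true → b u v ≡ false → g u y ≡ true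
    switch-blocked u v gxv≡false guv≡true buv≡false with g u y in guy
    ... | true  = refl
    ... | false = ⊥-elim (no-switch (u , v , gxv≡false , guv≡true , buv≡false , guy))
    few-non-neighbours : countTrue (not ∘ g x) ≤ colDeg g y * (T ∸ m)
    few-non-neighbours =
      nonNeighbours-≤ x y (b⊆g A) (rowDeg≤T A) m≤rowDeg colDeg-b<g switch-blocked

  complete : ∀ fuel g → Admissible g → sum (rowDeg g) + fuel ≡ capacity →
    Σ[ g′ ∈ Bigraph n ] b ⊆ᵇ g′ × IsRegular g′ T
  complete zero g A Σ≡ =
    g , b⊆g A , sum-≡⇒≗ (rowDeg≤T A) Σrow≡ , sum-≡⇒≗ (colDeg≤T A) (trans (sum-colDeg g) Σrow≡)
    where
    Σrow≡ : sum (rowDeg g) ≡ capacity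
    Σrow≡ = trans (sym (+-identityʳ _)) Σ≡
  complete (suc fuel) g A Σ≡ =
    let x , x<T = deficient-row
        y , y<T = deficient-col
        g′ , A′ , Σ′≡ = augment A x<T y<T
    in complete fuel g′ A′ (trans (cong (_+ fuel) Σ′≡) (trans (+-assoc (sum (rowDeg g)) 1 fuel) Σ≡))
    where
    Σrow< : sum (rowDeg g) < capacity
    Σrow< = subst (sum (rowDeg g) <_) Σ≡ (m<m+n _ z<s)
    deficient-row : ∃ λ x → rowDeg g x < T
    deficient-row = sum-<⇒∃< Σrow<
    deficient-col : ∃ λ y → colDeg g y < T
    deficient-col = sum-<⇒∃< (subst (_< capacity) (sym (sum-colDeg g)) Σrow<)

regular-completion : ∀ {n} T m (b : Bigraph n) → (∀ u → m ≤ rowDeg b u) → (∀ u → rowDeg b u ≤ T) →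
  (∀ v → colDeg b v < T) → pred T * (T ∸ m) + T ≤ n → Σ[ g ∈ Bigraph n ] b ⊆ᵇ g × IsRegular g T
regular-completion T m b m≤rowDeg rowDeg≤T colDeg<T large =
  complete (capacity ∸ sum (rowDeg b)) b
    (record { b⊆g = ⊆ᵇ-refl ; rowDeg≤T = rowDeg≤T ; colDeg≤T = <⇒≤ ∘ colDeg<T })
    (m+[n∸m]≡n (sum-mono-≤ rowDeg≤T))
  where open Completion T m b m≤rowDeg colDeg<T large

regular-step : ∀ {n T} {b : Bigraph n} → IsRegular b T → 2 * T < n →
  Σ[ g ∈ Bigraph n ] b ⊆ᵇ g × IsRegular g (suc T)
regular-step {n} {T} {b} (rows , cols) 2T<n =
  regular-completion (suc T) T b (λ u → ≤-reflexive (sym (rows u)))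
    (λ u → m≤n⇒m≤1+n (≤-reflexive (rows u))) (λ v → ≤-reflexive (cong suc (cols v))) large
  where
  open ≤-Reasoning
  large : T * (suc T ∸ T) + suc T ≤ n
  large = begin
    T * (suc T ∸ T) + suc T  ≡⟨ cong (λ c → T * c + suc T) (m+n∸n≡m 1 T) ⟩
    T * 1 + suc T            ≡⟨ solve 1 (λ t → t :* con 1 :+ (con 1 :+ t) := con 1 :+ con 2 :* t) refl T ⟩
    suc (2 * T)              ≤⟨ 2T<n ⟩
    n                        ∎
    where open ℕ-Solver

raise-regularity : ∀ {n T k} {b : Bigraph n} → IsRegular b T → T ≤′ k → 2 * k < n →
  Σ[ g ∈ Bigraph n ] b ⊆ᵇ g × IsRegular g k
raise-regularity reg ≤′-refl _ = _ , ⊆ᵇ-refl , reg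
raise-regularity {k = suc k} reg (≤′-step T≤′k) 2[k+1]<n =
  let g  , b⊆g  , reg-g  = raise-regularity reg T≤′k 2k<n
      g′ , g⊆g′ , reg-g′ = regular-step reg-g 2k<n
  in g′ , ⊆ᵇ-trans b⊆g g⊆g′ , reg-g′
  where
  2k<n = <-trans (*-monoʳ-< 2 (n<1+n k)) 2[k+1]<n

-- A single completion to degree k would need n ≥ k², so first complete to
-- T₀ = min(k, D + 1), which needs only n ≥ (D + 1)², and then raise the degree one at
-- a time, each step needing only 2k < n.
bipartite-completion : ∀ {n} k D (b : Bigraph n) →
  (∀ u → rowDeg b u < k) → (∀ v → colDeg b v < k) →
  (∀ u → rowDeg b u ≤ D) → (∀ v → colDeg b v ≤ D) →
  suc D * suc D ≤ n → 2 * k < n → Σ[ g ∈ Bigraph n ] b ⊆ᵇ g × IsRegular g k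
bipartite-completion {n} k D b rows<k cols<k rows≤D cols≤D [D+1]²≤n 2k<n =
  let g  , b⊆g  , reg  = regular-completion T₀ 0 b (λ _ → z≤n)
                           (λ u → <⇒≤ (below-T₀ (rows<k u) (rows≤D u)))
                           (λ v → below-T₀ (cols<k v) (cols≤D v)) large
      g′ , g⊆g′ , reg′ = raise-regularity reg (≤⇒≤′ (m⊓n≤m k (suc D))) 2k<n
  in g′ , ⊆ᵇ-trans b⊆g g⊆g′ , reg′
  where
  open ≤-Reasoning
  T₀ = k ⊓ suc D
  below-T₀ : ∀ {d} → d < k → d ≤ D → d < T₀
  below-T₀ d<k d≤D = ⊓-glb d<k (s≤s d≤D)
  pred[t]*t+t≡t*t : ∀ t → pred t * t + t ≡ t * t
  pred[t]*t+t≡t*t zero    = refl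
  pred[t]*t+t≡t*t (suc t) = +-comm (t * suc t) (suc t)
  large : pred T₀ * T₀ + T₀ ≤ n
  large = begin
    pred T₀ * T₀ + T₀  ≡⟨ pred[t]*t+t≡t*t T₀ ⟩
    T₀ * T₀            ≤⟨ *-mono-≤ (m⊓n≤n k (suc D)) (m⊓n≤n k (suc D)) ⟩
    suc D * suc D      ≤⟨ [D+1]²≤n ⟩
    n                  ∎

-- Gluing bipartite pieces along R

adj-sym : ∀ {V : Set} {E : V → V → Bool} → IsGraph E → ∀ u v → E u v ≡ E v u
adj-sym {E = E} G u v with E u v in euv | E v u in evu
... | true  | true  = refl
... | false | false = refl
... | true  | false = trans (sym (IsGraph.sym G u v euv)) evu
... | false | true  = trans (sym euv) (IsGraph.sym G v u evu)

module Gluing {r n} (R : Graph r) (P : Fin r → Fin r → Bigraph n)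
  (P⊆R : ∀ i j x y → P i j x y ≡ true → (i , j) ∈E R) where

  glue : Fin r × Fin n → Fin r × Fin n → Bool
  glue (i , x) (j , y) = if does (i Fin.<? j) then P i j x y else P j i y x

  glue-< : ∀ {i j} → i Fin.< j → ∀ x y → glue (i , x) (j , y) ≡ P i j x y
  glue-< {i} {j} i<j x y = cong (if_then P i j x y else P j i y x) (dec-true (i Fin.<? j) i<j)

  glue-≮ : ∀ {i j} → ¬ i Fin.< j → ∀ x y → glue (i , x) (j , y) ≡ P j i y x
  glue-≮ {i} {j} i≮j x y = cong (if_then P i j x y else P j i y x) (dec-false (i Fin.<? j) i≮j)

  no-loops : ∀ i x y → P i i x y ≢ true
  no-loops i x y = IsGraph.irrefl (isGraph R) i ∘ P⊆R i i x y

  glue-sym : ∀ u v → glue u v ≡ true → glue v u ≡ true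
  glue-sym (i , x) (j , y) e with i Fin.<? j | j Fin.<? i
  ... | yes i<j | _       = trans (glue-≮ (Fin.<-asym i<j) y x) (trans (sym (glue-< i<j x y)) e)
  ... | no i≮j  | yes j<i = trans (glue-< j<i y x) (trans (sym (glue-≮ i≮j x y)) e)
  ... | no i≮j  | no j≮i  with Fin.≤-antisym (≮⇒≥ j≮i) (≮⇒≥ i≮j)
  ...   | refl = ⊥-elim (no-loops i y x (trans (sym (glue-≮ i≮j x y)) e))

  glue-irrefl : ∀ u → glue u u ≢ true
  glue-irrefl (i , x) e = no-loops i x x (trans (sym (glue-≮ (Fin.<-irrefl refl) x x)) e)

  glued : PGraph r n
  glued = record { padj = glue ; pisGraph = record { sym = glue-sym ; irrefl = glue-irrefl } }

  glued-partition : HasVertexPartition R glued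
  glued-partition i j x y e with i Fin.<? j
  ... | yes i<j = P⊆R i j x y (trans (sym (glue-< i<j x y)) e)
  ... | no i≮j  = IsGraph.sym (isGraph R) j i (P⊆R j i y x (trans (sym (glue-≮ i≮j x y)) e))

  ⊆G-glued : (H : PGraph r n) → HasVertexPartition R H →
    (∀ i j → (i , j) ∈E R → (λ x y → padj H (i , x) (j , y)) ⊆ᵇ P i j) → H ⊆G glued
  ⊆G-glued H H-part H⊆P (i , x) (j , y) Hxy with i Fin.<? j
  ... | yes i<j = trans (glue-< i<j x y) (H⊆P i j ij∈R x y Hxy)
    where ij∈R = H-part i j x y Hxy
  ... | no i≮j  = trans (glue-≮ i≮j x y) (H⊆P j i ji∈R y x (IsGraph.sym (pisGraph H) (i , x) (j , y) Hxy))
    where ji∈R = IsGraph.sym (isGraph R) i j (H-part i j x y Hxy)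

  deg-glued : (k : Fin r → Fin r → ℕ) → (∀ i j → k i j ≡ k j i) →
    (∀ i j → (i , j) ∈E R → IsRegular (P i j) (k i j)) →
    ∀ i j → (i , j) ∈E R → ∀ x → deg glued i j x ≡ k i j
  deg-glued k k-sym P-regular i j ij∈R x with i Fin.<? j
  ... | yes i<j = trans (countTrue-cong (glue-< i<j x)) (proj₁ (P-regular i j ij∈R) x)
  ... | no i≮j  = trans (countTrue-cong (glue-≮ i≮j x))
                        (trans (proj₂ (P-regular j i (IsGraph.sym (isGraph R) i j ij∈R)) x) (k-sym j i))

partite-regular-extension : ∀ {r n} (R : Graph r) (k : Fin r → Fin r → ℕ) (D : ℕ) →
  (∀ i j → k i j ≡ k j i) → suc D * suc D ≤ n → (∀ i j → (i , j) ∈E R → 2 * k i j < n) →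
  (H : PGraph r n) → HasVertexPartition R H →
  (∀ i j → (i , j) ∈E R → ∀ x → deg H i j x < k i j × deg H i j x ≤ D) →
  Σ[ H′ ∈ PGraph r n ] HasVertexPartition R H′ × H ⊆G H′
    × (∀ i j → (i , j) ∈E R → ∀ x → deg H′ i j x ≡ k i j)
partite-regular-extension {r} {n} R k D k-sym [D+1]²≤n 2k<n H H-part deg-bounds =
  glued , glued-partition , ⊆G-glued H H-part (λ i j → proj₁ ∘ piece-spec i j) ,
  deg-glued k k-sym (λ i j → proj₂ ∘ piece-spec i j)
  where
  h : Fin r → Fin r → Bigraph n
  h i j x y = padj H (i , x) (j , y)
  colDeg-h : ∀ i j y → colDeg (h i j) y ≡ deg H j i y
  colDeg-h i j y = countTrue-cong (λ x → adj-sym (pisGraph H) (i , x) (j , y))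
  completion : ∀ i j → (i , j) ∈E R → Σ[ g ∈ Bigraph n ] h i j ⊆ᵇ g × IsRegular g (k i j)
  completion i j ij∈R = bipartite-completion (k i j) D (h i j)
    (λ x → proj₁ (deg-bounds i j ij∈R x))
    (λ y → subst₂ _<_ (sym (colDeg-h i j y)) (k-sym j i) (proj₁ (deg-bounds j i ji∈R y)))
    (λ x → proj₂ (deg-bounds i j ij∈R x))
    (λ y → subst (_≤ D) (sym (colDeg-h i j y)) (proj₂ (deg-bounds j i ji∈R y)))
    [D+1]²≤n (2k<n i j ij∈R)
    where ji∈R = IsGraph.sym (isGraph R) i j ij∈R
  piece : Fin r → Fin r → Bigraph n
  piece i j with adj R i j Bool.≟ true
  ... | yes ij∈R = proj₁ (completion i j ij∈R)
  ... | no _     = λ _ _ → false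
  piece-spec : ∀ i j → (i , j) ∈E R → h i j ⊆ᵇ piece i j × IsRegular (piece i j) (k i j)
  piece-spec i j ij∈R with adj R i j Bool.≟ true
  ... | yes ij∈R′ = proj₂ (completion i j ij∈R′)
  ... | no ij∉R   = ⊥-elim (ij∉R ij∈R)
  piece⊆R : ∀ i j x y → piece i j x y ≡ true → (i , j) ∈E R
  piece⊆R i j x y with adj R i j Bool.≟ true
  ... | yes ij∈R = λ _ → ij∈R
  ... | no _     = λ ()
  open Gluing R piece piece⊆R

lemma7p3 : ∀ (Δ : ℕ) → 1 ≤ Δ →
    ∃[ s₀ ] ∀ (s : ℕ) → s₀ ≤ s →
    ∃[ n₀ ] ∀ (n : ℕ) → n₀ ≤ n →
    ∀ (r : ℕ) (R : Graph r)
      (M : Fin r → Fin r → ℚ) (k : Fin r → Fin r → ℕ) →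
      (∀ i j → M i j ≡ M j i) →
      (∀ i j → k i j ≡ k j i) →
      (∀ i j → (i , j) ∈E R →
         (M i j ℚ.≤ ℕ→ℚ (2 * Δ * s))
         × (s^⅔ s ≤ (ℕ→ℚ (k i j) ℚ.- M i j ℚ.- ℕ→ℚ 1))
         × (2 * k i j < n)) →
    ∀ (H : PGraph r n) → HasVertexPartition R H →
      (∀ i j → (i , j) ∈E R → ∀ (x : Fin n) →
         ((M i j ℚ.- ℕ→ℚ 1 ℚ.- ℕ→ℚ (deg H i j x)) ≤s^⅔ s)
         × ((ℕ→ℚ (deg H i j x) ℚ.- M i j) ≤s^⅔ s)) →
    Σ[ H' ∈ PGraph r n ]
      HasVertexPartition R H' × (H ⊆G H')
      × (∀ i j → (i , j) ∈E R → ∀ (x : Fin n) → deg H' i j x ≡ k i j)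
lemma7p3 Δ _ = 1 , λ s 1≤s → suc (D s) * suc (D s) ,
  λ n [D+1]²≤n r R M k _ k-sym bounds H H-part degrees →
  partite-regular-extension R k (D s) k-sym [D+1]²≤n (λ i j ij∈R → proj₂ (proj₂ (bounds i j ij∈R)))
    H H-part (λ i j ij∈R x → degree-bounds 1≤s (proj₁ (bounds i j ij∈R)) (proj₁ (proj₂ (bounds i j ij∈R)))
                                          (proj₂ (degrees i j ij∈R x)))
  where
  D : ℕ → ℕ
  D s = 2 * Δ * s + s * s
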